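{- For every $n\ge 1$, $$M_n(q,t)=M_{n-1}(q,qt)+\sum_{k=2}^{n}\Big[M_{k-1}(q,t)+(q^{k-1}t-1)M_{k-2}(q,t)\Big]M_{n-k}(q,q^kt),$$ and $$M_n(q,t)=M_{n-1}(q,t)+\sum_{k=0}^{n-2}M_k(q,t)\Big[M_{n-k-1}(q,q^kt)+(q^{n-1}t-1)M_{n-k-2}(q,q^kt)\Big].$$
   Context: For a permutation $\sigma=b_1\ldots b_m$ of $[m]$, $\mathrm{des}\,\sigma=\#\{i:b_i>b_{i+1}\}$ and $\mathrm{maj}\,\sigma=\sum_{b_i>b_{i+1}}i$. $\mathrm{Av}_m(321)$ is the set of permutations of $[m]$ with no $i<j<k$ such that $b_i>b_j>b_k$. Define $M_m(q,t)=\sum_{\sigma\in\mathrm{Av}_m(321)}q^{\mathrm{maj}\,\sigma}t^{\mathrm{des}\,\sigma}$ for $m\ge0$, with $M_0(q,t)=1$; $M_m(q,u)$ denotes this polynomial with $t$ replaced by $u$. -}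

module Defs where

open import Level using (Level)
open import Data.Nat using (ℕ; zero; suc; _<ᵇ_)
open import Data.Bool using (Bool; true; false; if_then_else_; _∨_; _∧_; not)
open import Data.List using (List; []; _∷_; map; concatMap; filterᵇ; length; foldr; _++_)
open import Data.Nat.ListAction using (sum)
open import Data.Bool.ListAction using (any)
open import Algebra.Bundles using (CommutativeRing)

insertions : ℕ → List ℕ → List (List ℕ)
insertions x [] = (x ∷ []) ∷ []
insertions x (y ∷ ys) = (x ∷ y ∷ ys) ∷ map (y ∷_) (insertions x ys)

-- All permutations of [m] = {1,…,m}, in one-line notation b₁…bₘ
-- (each exactly once): insert m into every permutation of [m-1].
perms : ℕ → List (List ℕ)
perms zero = [] ∷ []
perms (suc m) = concatMap (insertions (suc m)) (perms m)

descentsFrom : ℕ → List ℕ → List ℕ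
descentsFrom i (a ∷ b ∷ rest) =
  (if b <ᵇ a then i ∷ [] else []) ++ descentsFrom (suc i) (b ∷ rest)
descentsFrom i _ = []

des : List ℕ → ℕ
des σ = length (descentsFrom 1 σ)

maj : List ℕ → ℕ
maj σ = sum (descentsFrom 1 σ)

has21Below : ℕ → List ℕ → Bool
has21Below a [] = false
has21Below a (b ∷ rest) = ((b <ᵇ a) ∧ any (λ c → c <ᵇ b) rest) ∨ has21Below a rest

contains321 : List ℕ → Bool
contains321 [] = false
contains321 (a ∷ rest) = has21Below a rest ∨ contains321 rest

Av321 : ℕ → List (List ℕ)
Av321 m = filterᵇ (λ σ → not (contains321 σ)) (perms m)

module _ {c ℓ : Level} (R : CommutativeRing c ℓ) where
  open CommutativeRing R

  pow : Carrier → ℕ → Carrier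
  pow x zero = 1#
  pow x (suc n) = x * pow x n

  sumR : List Carrier → Carrier
  sumR = foldr _+_ 0#

  M : ℕ → Carrier → Carrier → Carrier
  M m q t = sumR (map (λ σ → pow q (maj σ) * pow t (des σ)) (Av321 m))

module Submission where

-- Every 321-avoider of [m+1] arises uniquely from a 321-avoider
-- of [m] by inserting m+1 directly in front of an increasing suffix, and
-- the effect of such an insertion on (maj, des) depends only on the
-- position p of the last descent.  So the refined generating function
--   Φ m u φ = Σ_{σ ∈ Av_m(321)} q^{maj σ} u^{des σ} φ(p(σ))
-- satisfies a linear recursion Φ (m+1) u φ = Φ m u (transfer m u φ), and
-- M_m(q,u) = Φ m u 1.
--
-- The decomposition lemma Φ-decomposition writes Φ (N+1) as Φ N plus
--      a convolution of the M_k with operators K; for φ = 1 this is the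
--      second identity, with indecomposable factor
--      Ind b u = M_{b+1}(u) + (q^{b+1}u − 1) M_b(u).  The first identity is
--      derived from the second by strong induction and associativity of
--      convolutions.
--   3. Insertion: the combinatorics of inserting a maximum into a list
--      (which insertions avoid 321, and where the last descent goes).
--   4. Counting: Σ_{σ ∈ Av_m(321)} q^maj t^des φ(last descent) = Φ m t φ.
--   5. The theorem: translate the convolution sums into the list sums of
--      the statement.

open import Defs
open import Level using (Level; _⊔_)
open import Data.Nat using (ℕ; zero; suc; _∸_; _≤_; _<_; z≤n; s≤s; _<ᵇ_)
  renaming (_+_ to _+ⁿ_)
import Data.Nat.Properties as ℕ
open import Data.Nat.ListAction using (sum)
open import Data.Bool using (Bool; true; false; if_then_else_; _∨_; _∧_; not; T)
open import Data.Bool.ListAction using (any)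
import Data.Bool.Properties as Bool
open import Data.List using (List; []; _∷_; map; _++_; filterᵇ; concat; length; upTo; applyUpTo)
import Data.List.Properties as List
open import Data.List.Relation.Unary.All as All using (All; []; _∷_)
import Data.List.Relation.Unary.All.Properties as All
open import Data.Product using (_×_; _,_; proj₁; proj₂)
open import Data.Sum using (_⊎_; inj₁; inj₂)
open import Data.Empty using (⊥-elim)
open import Function using (_∘_; id)
open import Relation.Nullary.Decidable using (T?)
open import Relation.Binary.PropositionalEquality as ≡ using (_≡_)
open import Algebra.Bundles using (CommutativeRing)

-- 1. Finite sums in a commutative ring.
module FiniteSums {c ℓ : Level} (R : CommutativeRing c ℓ) where
  open CommutativeRing R hiding (zero)
  open import Relation.Binary.Reasoning.Setoid setoid
  open import Algebra.Properties.CommutativeSemigroup +-commutativeSemigroup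
    using () renaming (interchange to +-interchange)
  open import Algebra.Properties.CommutativeSemigroup *-commutativeSemigroup
    using (xy∙z≈y∙xz)

  infixr 8 _^_
  _^_ : Carrier → ℕ → Carrier
  x ^ n = pow R x n

  ^-+ : ∀ x m n → x ^ (m +ⁿ n) ≈ x ^ m * x ^ n
  ^-+ x zero n = sym (*-identityˡ _)
  ^-+ x (suc m) n = trans (*-congˡ (^-+ x m n)) (sym (*-assoc _ _ _))

  -- Substituting y ↦ x^a y and then y ↦ x^b y is substituting y ↦ x^{a+b} y.
  ^-split : ∀ x a b y → x ^ (a +ⁿ b) * y ≈ x ^ b * (x ^ a * y)
  ^-split x a b y = trans (*-congʳ (^-+ x a b)) (xy∙z≈y∙xz (x ^ a) (x ^ b) y)

  sumBelow : ℕ → (ℕ → Carrier) → Carrier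
  sumBelow zero f = 0#
  sumBelow (suc n) f = f 0 + sumBelow n (f ∘ suc)

  sumBelow-cong : ∀ n {f g} → (∀ i → i < n → f i ≈ g i) → sumBelow n f ≈ sumBelow n g
  sumBelow-cong zero h = refl
  sumBelow-cong (suc n) h =
    +-cong (h 0 (s≤s z≤n)) (sumBelow-cong n (λ i i<n → h (suc i) (s≤s i<n)))

  sumBelow-+ : ∀ n f g → sumBelow n (λ i → f i + g i) ≈ sumBelow n f + sumBelow n g
  sumBelow-+ zero f g = sym (+-identityˡ 0#)
  sumBelow-+ (suc n) f g =
    trans (+-congˡ (sumBelow-+ n (f ∘ suc) (g ∘ suc))) (+-interchange _ _ _ _)

  sumBelow-* : ∀ n x f → sumBelow n (λ i → x * f i) ≈ x * sumBelow n f
  sumBelow-* zero x f = sym (zeroʳ x)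
  sumBelow-* (suc n) x f = trans (+-congˡ (sumBelow-* n x (f ∘ suc))) (sym (distribˡ x _ _))

  sumBelow-snoc : ∀ n f → sumBelow (suc n) f ≈ sumBelow n f + f n
  sumBelow-snoc zero f = trans (+-identityʳ _) (sym (+-identityˡ _))
  sumBelow-snoc (suc n) f =
    trans (+-congˡ (sumBelow-snoc n (f ∘ suc))) (sym (+-assoc _ _ _))

  -- sumRange a b f = Σ_{a ≤ j ≤ b} f j.  Abstract, so that later proofs
  -- work with the interface below and never unfold the index arithmetic.
  abstract
    sumRange : ℕ → ℕ → (ℕ → Carrier) → Carrier
    sumRange a b f = sumBelow (suc b ∸ a) (λ i → f (a +ⁿ i))

    private
      sumBelow-≡ : ∀ {n m} f → n ≡ m → sumBelow n f ≈ sumBelow m f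
      sumBelow-≡ f n≡m = reflexive (≡.cong (λ n → sumBelow n f) n≡m)

      inRange : ∀ a b i → i < suc b ∸ a → a +ⁿ i ≤ b
      inRange zero b i (s≤s i≤b) = i≤b
      inRange (suc a) zero i i<0 = ⊥-elim (ℕ.n≮0 (≡.subst (i <_) (ℕ.0∸n≡0 a) i<0))
      inRange (suc a) (suc b) i i< = s≤s (inRange a b i i<)

    sumRange-cong : ∀ a b {f g} → (∀ j → a ≤ j → j ≤ b → f j ≈ g j) →
                    sumRange a b f ≈ sumRange a b g
    sumRange-cong a b h =
      sumBelow-cong (suc b ∸ a) (λ i i< → h (a +ⁿ i) (ℕ.m≤m+n a i) (inRange a b i i<))

    sumRange-cong-suc : ∀ a b {f g} → (∀ j → f (suc j) ≈ g (suc j)) →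
                        sumRange (suc a) b f ≈ sumRange (suc a) b g
    sumRange-cong-suc a b h = sumBelow-cong (suc b ∸ suc a) (λ i _ → h (a +ⁿ i))

    sumRange-+ : ∀ a b f g → sumRange a b (λ j → f j + g j) ≈ sumRange a b f + sumRange a b g
    sumRange-+ a b f g = sumBelow-+ (suc b ∸ a) _ _

    sumRange-* : ∀ a b x f → sumRange a b (λ j → x * f j) ≈ x * sumRange a b f
    sumRange-* a b x f = sumBelow-* (suc b ∸ a) x _

    sumRange-front : ∀ a b f → a ≤ b → sumRange a b f ≈ f a + sumRange (suc a) b f
    sumRange-front a b f a≤b = begin
      sumBelow (suc b ∸ a) (λ i → f (a +ⁿ i)) ≈⟨ sumBelow-≡ _ (ℕ.+-∸-assoc 1 a≤b) ⟩
      f (a +ⁿ 0) + sumBelow (b ∸ a) (λ i → f (a +ⁿ suc i))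
        ≈⟨ +-cong (reflexive (≡.cong f (ℕ.+-identityʳ a)))
                  (sumBelow-cong (b ∸ a) (λ i _ → reflexive (≡.cong f (ℕ.+-suc a i)))) ⟩
      f a + sumRange (suc a) b f ∎

    sumRange-snoc : ∀ a b f → a ≤ suc b → sumRange a (suc b) f ≈ sumRange a b f + f (suc b)
    sumRange-snoc a b f a≤ = begin
      sumBelow (suc (suc b) ∸ a) (λ i → f (a +ⁿ i)) ≈⟨ sumBelow-≡ _ (ℕ.+-∸-assoc 1 a≤) ⟩
      sumBelow (suc (suc b ∸ a)) (λ i → f (a +ⁿ i)) ≈⟨ sumBelow-snoc (suc b ∸ a) _ ⟩
      sumRange a b f + f (a +ⁿ (suc b ∸ a))         ≈⟨ +-congˡ (reflexive (≡.cong f (ℕ.m+[n∸m]≡n a≤))) ⟩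
      sumRange a b f + f (suc b) ∎

    sumRange-empty : ∀ a b f → b < a → sumRange a b f ≈ 0#
    sumRange-empty a b f b<a = sumBelow-≡ _ (ℕ.m≤n⇒m∸n≡0 b<a)

    sumRange-shift : ∀ k a b f → sumRange (k +ⁿ a) (k +ⁿ b) f ≈ sumRange a b (λ j → f (k +ⁿ j))
    sumRange-shift zero a b f = refl
    sumRange-shift (suc k) a b f = sumRange-shift k a b (f ∘ suc)

  sumRange-≡ : ∀ {a a′ b b′} f → a ≡ a′ → b ≡ b′ → sumRange a b f ≈ sumRange a′ b′ f
  sumRange-≡ f ≡.refl ≡.refl = refl

  sumRange-cong′ : ∀ a b {f g} → (∀ j → f j ≈ g j) → sumRange a b f ≈ sumRange a b g
  sumRange-cong′ a b h = sumRange-cong a b (λ j _ _ → h j)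

  sumRange-single : ∀ a f → sumRange a a f ≈ f a
  sumRange-single a f = begin
    sumRange a a f                 ≈⟨ sumRange-front a a f ℕ.≤-refl ⟩
    f a + sumRange (suc a) a f     ≈⟨ +-congˡ (sumRange-empty (suc a) a f ℕ.≤-refl) ⟩
    f a + 0#                       ≈⟨ +-identityʳ _ ⟩
    f a ∎

  sumOver : {A : Set} → (A → Carrier) → List A → Carrier
  sumOver f L = sumR R (map f L)

  sumOver-++ : {A : Set} (f : A → Carrier) (L₁ L₂ : List A) →
               sumOver f (L₁ ++ L₂) ≈ sumOver f L₁ + sumOver f L₂
  sumOver-++ f [] L₂ = sym (+-identityˡ _)
  sumOver-++ f (x ∷ L₁) L₂ = trans (+-congˡ (sumOver-++ f L₁ L₂)) (sym (+-assoc _ _ _))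

  sumOver-map : {A B : Set} (f : B → Carrier) (g : A → B) (L : List A) →
                sumOver f (map g L) ≡ sumOver (f ∘ g) L
  sumOver-map f g L = ≡.cong (sumR R) (≡.sym (List.map-∘ L))

  sumOver-cong : {A : Set} {f g : A → Carrier} (L : List A) → (∀ x → f x ≈ g x) →
                 sumOver f L ≈ sumOver g L
  sumOver-cong [] h = refl
  sumOver-cong (x ∷ L) h = +-cong (h x) (sumOver-cong L h)

  sumOver-congAll : {A : Set} {f g : A → Carrier} {L : List A} → All (λ x → f x ≈ g x) L →
                    sumOver f L ≈ sumOver g L
  sumOver-congAll [] = refl
  sumOver-congAll (h ∷ hs) = +-cong h (sumOver-congAll hs)

  sumOver-* : {A : Set} (x : Carrier) (f : A → Carrier) (L : List A) →
              sumOver (λ a → x * f a) L ≈ x * sumOver f L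
  sumOver-* x f [] = sym (zeroʳ x)
  sumOver-* x f (a ∷ L) = trans (+-congˡ (sumOver-* x f L)) (sym (distribˡ x _ _))

  sumOver-concat : {A B : Set} (f : B → Carrier) (g : A → List B) (L : List A) →
                   sumOver f (concat (map g L)) ≈ sumOver (λ a → sumOver f (g a)) L
  sumOver-concat f g [] = refl
  sumOver-concat f g (a ∷ L) = trans (sumOver-++ f (g a) _) (+-congˡ (sumOver-concat f g L))

  sumOver-filter : {A : Set} (p : A → Bool) (f : A → Carrier) (L : List A) →
                   sumOver f (filterᵇ p L) ≈ sumOver (λ a → if p a then f a else 0#) L
  sumOver-filter p f [] = refl
  sumOver-filter p f (a ∷ L) with p a
  ... | true = +-congˡ (sumOver-filter p f L)
  ... | false = trans (sumOver-filter p f L) (sym (+-identityˡ _))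

  sumOver-applyUpTo : (f : ℕ → Carrier) (g : ℕ → ℕ) (n : ℕ) →
                      sumOver f (applyUpTo g n) ≈ sumBelow n (f ∘ g)
  sumOver-applyUpTo f g zero = refl
  sumOver-applyUpTo f g (suc n) = +-congˡ (sumOver-applyUpTo f (g ∘ suc) n)

  -- Antidiagonal sums:  diag n g = Σ_{k+j = n} g k j  and
  -- diag₋ n g = Σ_{k+j+1 = n} g k j  (empty for n = 0).  The recursion
  -- peels off the term with j = 0.
  diag : ℕ → (ℕ → ℕ → Carrier) → Carrier
  diag zero g = g 0 0
  diag (suc n) g = diag n (λ k j → g k (suc j)) + g (suc n) 0

  diag₋ : ℕ → (ℕ → ℕ → Carrier) → Carrier
  diag₋ zero g = 0#
  diag₋ (suc n) g = diag n g

  diag-cong : ∀ n {g h} → (∀ k j → k +ⁿ j ≡ n → g k j ≈ h k j) → diag n g ≈ diag n h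
  diag-cong zero hyp = hyp 0 0 ≡.refl
  diag-cong (suc n) hyp =
    +-cong (diag-cong n (λ k j e → hyp k (suc j) (≡.trans (ℕ.+-suc k j) (≡.cong suc e))))
           (hyp (suc n) 0 (≡.cong suc (ℕ.+-identityʳ n)))

  diag₋-cong : ∀ n {g h} → (∀ k j → suc (k +ⁿ j) ≡ n → g k j ≈ h k j) → diag₋ n g ≈ diag₋ n h
  diag₋-cong zero hyp = refl
  diag₋-cong (suc n) hyp = diag-cong n (λ k j e → hyp k j (≡.cong suc e))

  diag-last : ∀ n g → diag n g ≈ diag₋ n (λ k j → g k (suc j)) + g n 0
  diag-last zero g = sym (+-identityˡ _)
  diag-last (suc n) g = refl

  diag-first : ∀ n g → diag n g ≈ g 0 n + diag₋ n (λ k j → g (suc k) j)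
  diag-first zero g = sym (+-identityʳ _)
  diag-first (suc n) g = begin
    diag n (λ k j → g k (suc j)) + g (suc n) 0
      ≈⟨ +-congʳ (diag-first n (λ k j → g k (suc j))) ⟩
    (g 0 (suc n) + diag₋ n (λ k j → g (suc k) (suc j))) + g (suc n) 0
      ≈⟨ +-assoc _ _ _ ⟩
    g 0 (suc n) + (diag₋ n (λ k j → g (suc k) (suc j)) + g (suc n) 0)
      ≈⟨ +-congˡ (sym (diag-last n (λ k j → g (suc k) j))) ⟩
    g 0 (suc n) + diag₋ (suc n) (λ k j → g (suc k) j) ∎

  diag-+ : ∀ n g h → diag n (λ k j → g k j + h k j) ≈ diag n g + diag n h
  diag-+ zero g h = refl
  diag-+ (suc n) g h =
    trans (+-congʳ (diag-+ n (λ k j → g k (suc j)) (λ k j → h k (suc j)))) (+-interchange _ _ _ _)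

  diag-*ʳ : ∀ n g x → diag n g * x ≈ diag n (λ k j → g k j * x)
  diag-*ʳ zero g x = refl
  diag-*ʳ (suc n) g x = trans (distribʳ x _ _) (+-congʳ (diag-*ʳ n _ x))

  diag-*ˡ : ∀ n g x → x * diag n g ≈ diag n (λ k j → x * g k j)
  diag-*ˡ zero g x = refl
  diag-*ˡ (suc n) g x = trans (distribˡ x _ _) (+-congʳ (diag-*ˡ n _ x))

  -- Associativity of convolution: both sides are Σ_{a+c+j = n} F a c j.
  diag-assoc : ∀ n (F : ℕ → ℕ → ℕ → Carrier) →
    diag n (λ k j → diag k (λ a c → F a c j)) ≈ diag n (λ a m → diag m (λ c j → F a c j))
  diag-assoc zero F = refl
  diag-assoc (suc n) F = begin
    diag n (λ k j → diag k (λ a c → F a c (suc j))) + diag (suc n) (λ a c → F a c 0)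
      ≈⟨ +-congʳ (diag-assoc n (λ a c j → F a c (suc j))) ⟩
    diag n (λ a m → diag m (λ c j → F a c (suc j))) + (diag n (λ a c → F a (suc c) 0) + F (suc n) 0 0)
      ≈⟨ sym (+-assoc _ _ _) ⟩
    (diag n (λ a m → diag m (λ c j → F a c (suc j))) + diag n (λ a c → F a (suc c) 0)) + F (suc n) 0 0
      ≈⟨ +-congʳ (sym (diag-+ n _ _)) ⟩
    diag (suc n) (λ a m → diag m (λ c j → F a c j)) ∎

  sumBelow-diag₋ : ∀ n (h : ℕ → Carrier) g → (∀ k j → suc (k +ⁿ j) ≡ n → h k ≈ g k j) →
                   sumBelow n h ≈ diag₋ n g
  sumBelow-diag₋ zero h g hyp = refl
  sumBelow-diag₋ (suc n) h g hyp = begin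
    sumBelow (suc n) h ≈⟨ sumBelow-snoc n h ⟩
    sumBelow n h + h n
      ≈⟨ +-cong (sumBelow-diag₋ n h (λ k j → g k (suc j))
                  (λ k j e → hyp k (suc j) (≡.cong suc (≡.trans (ℕ.+-suc k j) e))))
                (hyp n 0 (≡.cong suc (ℕ.+-identityʳ n))) ⟩
    diag₋ n (λ k j → g k (suc j)) + g n 0 ≈⟨ sym (diag-last n g) ⟩
    diag₋ (suc n) g ∎

-- 2. The transfer operators and the algebra of the two identities.
--
-- A "state" φ : ℕ → Carrier assigns a weight to the position p of the last
-- descent of a permutation, with p = 0 meaning "no descent".
module Transfer {c ℓ : Level} (R : CommutativeRing c ℓ) (q : CommutativeRing.Carrier R) where
  open CommutativeRing R hiding (zero)
  open FiniteSums R
  open import Relation.Binary.Reasoning.Setoid setoid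
  open import Algebra.Solver.Ring.NaturalCoefficients.Default commutativeSemiring
    using (solve; _:=_; _:+_; _:*_)
  open import Algebra.Properties.CommutativeSemigroup +-commutativeSemigroup
    using () renaming (interchange to +-interchange)
  open import Algebra.Properties.CommutativeSemigroup *-commutativeSemigroup
    using (x∙yz≈y∙xz; x∙yz≈yx∙z)
  open import Data.Nat.Induction using (<-rec)

  scale : (ℕ → Carrier) → ℕ → Carrier
  scale φ j = q ^ j * φ j

  -- Insert m+1 into a 321-avoider of length m with last descent p so that
  -- a new last descent j is created (factor u q^j): if p = 0, any
  -- j ∈ [1, m]; if p ≥ 1, either j = p+1, which replaces the old descent
  -- (factor q only), or j ∈ [p+2, m].
  newDescent : ℕ → Carrier → (ℕ → Carrier) → ℕ → Carrier
  newDescent m u φ zero = u * sumRange 1 m (scale φ)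
  newDescent m u φ (suc p) =
    q * φ (suc (suc p)) + u * sumRange (suc (suc (suc p))) m (scale φ)

  -- All admissible insertions of m+1: at the end (nothing changes), or
  -- creating a new last descent.
  transfer : ℕ → Carrier → (ℕ → Carrier) → ℕ → Carrier
  transfer m u φ p = φ p + newDescent m u φ p

  -- Φ m u φ = Σ_{σ ∈ Av_m(321)} q^{maj σ} u^{des σ} φ(last descent of σ),
  -- defined by the insertion recursion (Counting.Av321-sum proves the sum).
  Φ : ℕ → Carrier → (ℕ → Carrier) → Carrier
  Φ zero u φ = φ 0
  Φ (suc m) u φ = Φ m u (transfer m u φ)

  Mᵣ : ℕ → Carrier → Carrier
  Mᵣ m u = Φ m u (λ _ → 1#)

  -- The last descent of a permutation of length b is 0 or below b; Φ b
  -- only evaluates its state at such positions.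
  Reachable : ℕ → ℕ → Set
  Reachable b p = p < b ⊎ p ≡ 0

  shift : ℕ → (ℕ → Carrier) → ℕ → Carrier
  shift k φ p = φ (k +ⁿ p)

  -- K b u φ: the generating function of the insertions creating a new
  -- descent at level b+1, propagated through the remaining b levels.
  K : ℕ → Carrier → (ℕ → Carrier) → Carrier
  K b u φ = Φ b u (newDescent (suc b) u φ)

  Ind : ℕ → Carrier → Carrier
  Ind b u = Mᵣ (suc b) u + (q ^ suc b * u - 1#) * Mᵣ b u

  A : ℕ → Carrier → Carrier
  A zero u = 1#
  A (suc b) u = Ind b u

  newDescent-cong : ∀ m u {φ ψ} p → (∀ j → j ≤ m → φ j ≈ ψ j) → suc p ≤ m ⊎ p ≡ 0 →
                    newDescent m u φ p ≈ newDescent m u ψ p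
  newDescent-cong m u zero h _ = *-congˡ (sumRange-cong 1 m (λ j _ j≤ → *-congˡ (h j j≤)))
  newDescent-cong m u (suc p) h (inj₁ p<m) =
    +-cong (*-congˡ (h (suc (suc p)) p<m)) (*-congˡ (sumRange-cong _ m (λ j _ j≤ → *-congˡ (h j j≤))))

  newDescent-cong⁺ : ∀ m u {φ ψ} p → (∀ j → φ (suc j) ≈ ψ (suc j)) →
                     newDescent m u φ p ≈ newDescent m u ψ p
  newDescent-cong⁺ m u zero h = *-congˡ (sumRange-cong-suc 0 m (λ j → *-congˡ (h j)))
  newDescent-cong⁺ m u (suc p) h =
    +-cong (*-congˡ (h (suc p))) (*-congˡ (sumRange-cong-suc _ m (λ j → *-congˡ (h j))))

  Φ-cong : ∀ b u {χ₁ χ₂} → (∀ p → Reachable b p → χ₁ p ≈ χ₂ p) → Φ b u χ₁ ≈ Φ b u χ₂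
  Φ-cong zero u h = h 0 (inj₂ ≡.refl)
  Φ-cong (suc b) u h = Φ-cong b u λ p r →
    +-cong (h p (widen r)) (newDescent-cong b u p (λ j j≤ → h j (inj₁ (s≤s j≤))) (below p r))
    where
    widen : ∀ {p} → Reachable b p → Reachable (suc b) p
    widen (inj₁ p<b) = inj₁ (ℕ.m≤n⇒m≤1+n p<b)
    widen (inj₂ p≡0) = inj₂ p≡0
    below : ∀ p → Reachable b p → suc p ≤ b ⊎ p ≡ 0
    below zero _ = inj₂ ≡.refl
    below (suc p) (inj₁ p<b) = inj₁ p<b

  Φ-cong′ : ∀ b u {χ₁ χ₂} → (∀ p → χ₁ p ≈ χ₂ p) → Φ b u χ₁ ≈ Φ b u χ₂
  Φ-cong′ b u h = Φ-cong b u (λ p _ → h p)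

  Φ-congᵘ : ∀ b {u₁ u₂} χ → u₁ ≈ u₂ → Φ b u₁ χ ≈ Φ b u₂ χ
  Φ-congᵘ zero χ e = refl
  Φ-congᵘ (suc b) {u₁} {u₂} χ e =
    trans (Φ-congᵘ b (transfer b u₁ χ) e) (Φ-cong′ b u₂ (λ p → +-congˡ (newDescent-congᵘ p)))
    where
    newDescent-congᵘ : ∀ p → newDescent b u₁ χ p ≈ newDescent b u₂ χ p
    newDescent-congᵘ zero = *-congʳ e
    newDescent-congᵘ (suc p) = +-congˡ (*-congʳ e)

  Mᵣ-congᵘ : ∀ b {u₁ u₂} → u₁ ≈ u₂ → Mᵣ b u₁ ≈ Mᵣ b u₂
  Mᵣ-congᵘ b e = Φ-congᵘ b (λ _ → 1#) e

  A-congᵘ : ∀ j {u₁ u₂} → u₁ ≈ u₂ → A j u₁ ≈ A j u₂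
  A-congᵘ zero e = refl
  A-congᵘ (suc b) e = +-cong (Mᵣ-congᵘ (suc b) e) (*-cong (+-congʳ (*-congˡ e)) (Mᵣ-congᵘ b e))

  sumRange-scale-+ : ∀ a m φ ψ →
    sumRange a m (scale (λ i → φ i + ψ i)) ≈ sumRange a m (scale φ) + sumRange a m (scale ψ)
  sumRange-scale-+ a m φ ψ = trans (sumRange-cong′ a m (λ j → distribˡ _ _ _)) (sumRange-+ a m _ _)

  sumRange-scale-* : ∀ a m x φ → sumRange a m (scale (λ i → x * φ i)) ≈ x * sumRange a m (scale φ)
  sumRange-scale-* a m x φ =
    trans (sumRange-cong′ a m (λ j → x∙yz≈y∙xz (q ^ j) x (φ j))) (sumRange-* a m x _)

  newDescent-+ : ∀ m u φ ψ p →
    newDescent m u (λ i → φ i + ψ i) p ≈ newDescent m u φ p + newDescent m u ψ p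
  newDescent-+ m u φ ψ zero = trans (*-congˡ (sumRange-scale-+ 1 m φ ψ)) (distribˡ u _ _)
  newDescent-+ m u φ ψ (suc p) =
    trans (+-cong (distribˡ q _ _) (trans (*-congˡ (sumRange-scale-+ _ m φ ψ)) (distribˡ u _ _)))
          (+-interchange _ _ _ _)

  newDescent-* : ∀ m u x φ p → newDescent m u (λ i → x * φ i) p ≈ x * newDescent m u φ p
  newDescent-* m u x φ zero = trans (*-congˡ (sumRange-scale-* 1 m x φ)) (x∙yz≈y∙xz u x _)
  newDescent-* m u x φ (suc p) = begin
    q * (x * φ (suc (suc p))) + u * sumRange (suc (suc (suc p))) m (scale (λ i → x * φ i))
      ≈⟨ +-cong (x∙yz≈y∙xz q x _) (trans (*-congˡ (sumRange-scale-* _ m x φ)) (x∙yz≈y∙xz u x _)) ⟩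
    x * (q * φ (suc (suc p))) + x * (u * sumRange (suc (suc (suc p))) m (scale φ))
      ≈⟨ sym (distribˡ x _ _) ⟩
    x * newDescent m u φ (suc p) ∎

  Φ-+ : ∀ b u φ ψ → Φ b u (λ p → φ p + ψ p) ≈ Φ b u φ + Φ b u ψ
  Φ-+ zero u φ ψ = refl
  Φ-+ (suc b) u φ ψ = trans (Φ-cong′ b u transfer-+) (Φ-+ b u _ _)
    where
    transfer-+ : ∀ p → transfer b u (λ i → φ i + ψ i) p ≈ transfer b u φ p + transfer b u ψ p
    transfer-+ p = trans (+-congˡ (newDescent-+ b u φ ψ p)) (+-interchange _ _ _ _)

  Φ-* : ∀ b u x φ → Φ b u (λ p → x * φ p) ≈ x * Φ b u φ
  Φ-* zero u x φ = refl
  Φ-* (suc b) u x φ = trans (Φ-cong′ b u transfer-*) (Φ-* b u x _)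
    where
    transfer-* : ∀ p → transfer b u (λ i → x * φ i) p ≈ x * transfer b u φ p
    transfer-* p = trans (+-congˡ (newDescent-* b u x φ p)) (sym (distribˡ x _ _))

  Φ-+const : ∀ b u φ x → Φ b u (λ p → φ p + x) ≈ Φ b u φ + x * Mᵣ b u
  Φ-+const b u φ x =
    trans (Φ-+ b u φ (λ _ → x)) (+-congˡ (trans (Φ-cong′ b u (λ _ → sym (*-identityʳ x))) (Φ-* b u x _)))

  newDescent-extend : ∀ N u φ p → Reachable N p →
    newDescent (suc N) u φ p ≈ newDescent N u φ p + u * scale φ (suc N)
  newDescent-extend N u φ zero _ =
    trans (*-congˡ (sumRange-snoc 1 N (scale φ) (s≤s z≤n))) (distribˡ u _ _)
  newDescent-extend N u φ (suc p) (inj₁ p<N) = begin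
    q * φ (suc (suc p)) + u * sumRange (suc (suc (suc p))) (suc N) (scale φ)
      ≈⟨ +-congˡ (*-congˡ (sumRange-snoc _ N (scale φ) (s≤s p<N))) ⟩
    q * φ (suc (suc p)) + u * (sumRange (suc (suc (suc p))) N (scale φ) + scale φ (suc N))
      ≈⟨ solve 4 (λ a u b c → (a :+ (u :* (b :+ c))) := ((a :+ (u :* b)) :+ (u :* c)))
               refl (q * φ (suc (suc p))) u (sumRange (suc (suc (suc p))) N (scale φ)) (scale φ (suc N)) ⟩
    newDescent N u φ (suc p) + u * scale φ (suc N) ∎

  transfer-extend : ∀ N u φ p → Reachable N p →
    transfer (suc N) u φ p ≈ transfer N u φ p + u * scale φ (suc N)
  transfer-extend N u φ p r = trans (+-congˡ (newDescent-extend N u φ p r)) (sym (+-assoc _ _ _))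

  -- Shifting positions by k turns the weight q^j into q^k q^j, i.e. the
  -- variable t into q^k t.
  transfer-shift : ∀ k b t φ p →
    transfer (suc (suc (k +ⁿ b))) t φ (k +ⁿ suc p) ≈ transfer (suc (suc b)) (q ^ k * t) (shift k φ) (suc p)
  transfer-shift k b t φ p = begin
    transfer top t φ (k +ⁿ suc p) ≈⟨ reflexive (≡.cong (transfer top t φ) (ℕ.+-suc k p)) ⟩
    φ (suc (k +ⁿ p)) + (q * φ (suc (suc (k +ⁿ p))) + t * sumRange (suc (suc (suc (k +ⁿ p)))) top (scale φ))
      ≈⟨ +-cong (reflexive (≡.cong φ (≡.sym (ℕ.+-suc k p))))
                (+-cong (*-congˡ (reflexive (≡.cong φ e₂))) (*-congˡ shifted-sum)) ⟩
    φ (k +ⁿ suc p) + (q * φ (k +ⁿ suc (suc p)) + t * (q ^ k * Sₖ))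
      ≈⟨ +-congˡ (+-congˡ (x∙yz≈yx∙z t (q ^ k) Sₖ)) ⟩
    transfer (suc (suc b)) (q ^ k * t) (shift k φ) (suc p) ∎
    where
    top = suc (suc (k +ⁿ b))
    Sₖ = sumRange (suc (suc (suc p))) (suc (suc b)) (scale (shift k φ))
    e₂ : suc (suc (k +ⁿ p)) ≡ k +ⁿ suc (suc p)
    e₂ = ≡.trans (≡.cong suc (≡.sym (ℕ.+-suc k p))) (≡.sym (ℕ.+-suc k (suc p)))
    e₃ : suc (suc (suc (k +ⁿ p))) ≡ k +ⁿ suc (suc (suc p))
    e₃ = ≡.trans (≡.cong suc e₂) (≡.sym (ℕ.+-suc k (suc (suc p))))
    e₄ : top ≡ k +ⁿ suc (suc b)
    e₄ = ≡.trans (≡.cong suc (≡.sym (ℕ.+-suc k b))) (≡.sym (ℕ.+-suc k (suc b)))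
    shifted-sum : sumRange (suc (suc (suc (k +ⁿ p)))) top (scale φ) ≈ q ^ k * Sₖ
    shifted-sum = begin
      sumRange (suc (suc (suc (k +ⁿ p)))) top (scale φ)
        ≈⟨ sumRange-≡ (scale φ) e₃ e₄ ⟩
      sumRange (k +ⁿ suc (suc (suc p))) (k +ⁿ suc (suc b)) (scale φ)
        ≈⟨ sumRange-shift k (suc (suc (suc p))) (suc (suc b)) (scale φ) ⟩
      sumRange (suc (suc (suc p))) (suc (suc b)) (λ j → q ^ (k +ⁿ j) * φ (k +ⁿ j))
        ≈⟨ sumRange-cong′ _ _ (λ j → trans (*-congʳ (^-+ q k j)) (*-assoc (q ^ k) (q ^ j) (φ (k +ⁿ j)))) ⟩
      sumRange (suc (suc (suc p))) (suc (suc b)) (λ j → q ^ k * scale (shift k φ) j)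
        ≈⟨ sumRange-* _ _ (q ^ k) (scale (shift k φ)) ⟩
      q ^ k * Sₖ ∎

  newDescent-top : ∀ b u χ → newDescent (suc (suc b)) u χ (suc b) ≈ q * χ (suc (suc b))
  newDescent-top b u χ =
    trans (+-congˡ (trans (*-congˡ (sumRange-empty (suc (suc (suc b))) (suc (suc b)) (scale χ) ℕ.≤-refl))
                          (zeroʳ u)))
          (+-identityʳ _)

  newDescent-transfer : ∀ b u χ p → Reachable b p →
    newDescent (suc b) u (transfer (suc (suc b)) u χ) p ≈ transfer b u (newDescent (suc (suc b)) u χ) p
  newDescent-transfer b u χ = go
    where
    Tχ = transfer (suc (suc b)) u χ
    Dχ = newDescent (suc (suc b)) u χ
    add-top : ∀ a → a ≤ suc b →
              sumRange a (suc b) (scale Dχ) ≈ sumRange a b (scale Dχ) + q ^ suc b * (q * χ (suc (suc b)))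
    add-top a a≤ = trans (sumRange-snoc a b (scale Dχ) a≤) (+-congˡ (*-congˡ (newDescent-top b u χ)))
    go : ∀ p → Reachable b p → newDescent (suc b) u Tχ p ≈ transfer b u Dχ p
    go zero _ = begin
      u * sumRange 1 (suc b) (scale Tχ)
        ≈⟨ *-congˡ (sumRange-scale-+ 1 (suc b) χ Dχ) ⟩
      u * (sumRange 1 (suc b) (scale χ) + sumRange 1 (suc b) (scale Dχ))
        ≈⟨ *-congˡ (+-congˡ (add-top 1 (s≤s z≤n))) ⟩
      u * (sumRange 1 (suc b) (scale χ) + (sumRange 1 b (scale Dχ) + q ^ suc b * (q * χ (suc (suc b)))))
        ≈⟨ solve 6 (λ u A B P q X → (u :* (A :+ (B :+ (P :* (q :* X))))) := ((u :* (A :+ ((q :* P) :* X))) :+ (u :* B)))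
                 refl u (sumRange 1 (suc b) (scale χ)) (sumRange 1 b (scale Dχ)) (q ^ suc b) q (χ (suc (suc b))) ⟩
      u * (sumRange 1 (suc b) (scale χ) + scale χ (suc (suc b))) + u * sumRange 1 b (scale Dχ)
        ≈⟨ +-congʳ (*-congˡ (sym (sumRange-snoc 1 (suc b) (scale χ) (s≤s z≤n)))) ⟩
      transfer b u Dχ zero ∎
    go (suc p) (inj₁ p<b) = begin
      q * Tχ (suc (suc p)) + u * sumRange a (suc b) (scale Tχ)
        ≈⟨ +-congˡ (*-congˡ (sumRange-scale-+ a (suc b) χ Dχ)) ⟩
      q * (χ (suc (suc p)) + Dχ (suc (suc p))) + u * (sumRange a (suc b) (scale χ) + sumRange a (suc b) (scale Dχ))
        ≈⟨ +-congˡ (*-congˡ (+-congˡ (add-top a (s≤s p<b)))) ⟩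
      q * (χ (suc (suc p)) + Dχ (suc (suc p)))
        + u * (sumRange a (suc b) (scale χ) + (sumRange a b (scale Dχ) + q ^ suc b * (q * χ (suc (suc b)))))
        ≈⟨ solve 8 (λ q X₁ Y u A B P X → ((q :* (X₁ :+ Y)) :+ (u :* (A :+ (B :+ (P :* (q :* X))))))
                                     := (((q :* X₁) :+ (u :* (A :+ ((q :* P) :* X)))) :+ ((q :* Y) :+ (u :* B))))
                 refl q (χ (suc (suc p))) (Dχ (suc (suc p))) u (sumRange a (suc b) (scale χ))
                 (sumRange a b (scale Dχ)) (q ^ suc b) (χ (suc (suc b))) ⟩
      (q * χ (suc (suc p)) + u * (sumRange a (suc b) (scale χ) + scale χ (suc (suc b))))
        + (q * Dχ (suc (suc p)) + u * sumRange a b (scale Dχ))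
        ≈⟨ +-congʳ (+-congˡ (*-congˡ (sym (sumRange-snoc a (suc b) (scale χ) (ℕ.m≤n⇒m≤1+n (s≤s p<b)))))) ⟩
      transfer b u Dχ (suc p) ∎
      where a = suc (suc (suc p))

  K-step : ∀ k b t φ →
    K b (q ^ k * t) (shift k (transfer (suc (suc (k +ⁿ b))) t φ)) ≈ K (suc b) (q ^ k * t) (shift k φ)
  K-step k b t φ =
    trans (Φ-cong′ b u (λ p → newDescent-cong⁺ (suc b) u p (λ j → transfer-shift k b t φ j)))
          (Φ-cong b u (λ p r → newDescent-transfer b u (shift k φ) p r))
    where u = q ^ k * t

  -- Decomposition of Φ (N+1): the insertions of N+1 at the end give Φ N;
  -- the rest is a convolution of M_k(t) with K b (q^k t), k+b+1 = N.  By
  -- induction on N, moving the outermost transfer into K with K-step.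
  Φ-decomposition : ∀ N t φ →
    Φ (suc N) t φ ≈ Φ N t φ + diag₋ N (λ k b → Mᵣ k t * K b (q ^ k * t) (shift k φ))
  Φ-decomposition zero t φ = +-congˡ (trans (*-congˡ (sumRange-empty 1 0 (scale φ) (s≤s z≤n))) (zeroʳ t))
  Φ-decomposition (suc N) t φ = begin
    Φ (suc N) t (transfer (suc N) t φ) ≈⟨ Φ-decomposition N t (transfer (suc N) t φ) ⟩
    Φ N t (transfer (suc N) t φ) + diag₋ N (λ k b → Mᵣ k t * K b (q ^ k * t) (shift k (transfer (suc N) t φ)))
      ≈⟨ +-cong top-level lower-levels ⟩
    (Φ (suc N) t φ + Mᵣ N t * K 0 (q ^ N * t) (shift N φ)) + diag₋ N (λ k b → Mᵣ k t * K (suc b) (q ^ k * t) (shift k φ))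
      ≈⟨ trans (+-assoc _ _ _) (+-congˡ (+-comm _ _)) ⟩
    Φ (suc N) t φ + (diag₋ N (λ k b → Mᵣ k t * K (suc b) (q ^ k * t) (shift k φ)) + Mᵣ N t * K 0 (q ^ N * t) (shift N φ))
      ≈⟨ +-congˡ (sym (diag-last N (λ k b → Mᵣ k t * K b (q ^ k * t) (shift k φ)))) ⟩
    Φ (suc N) t φ + diag₋ (suc N) (λ k b → Mᵣ k t * K b (q ^ k * t) (shift k φ)) ∎
    where
    top-level : Φ N t (transfer (suc N) t φ) ≈ Φ (suc N) t φ + Mᵣ N t * K 0 (q ^ N * t) (shift N φ)
    top-level = begin
      Φ N t (transfer (suc N) t φ) ≈⟨ Φ-cong N t (λ p r → transfer-extend N t φ p r) ⟩
      Φ N t (λ p → transfer N t φ p + t * scale φ (suc N)) ≈⟨ Φ-+const N t (transfer N t φ) _ ⟩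
      Φ N t (transfer N t φ) + (t * (q ^ suc N * φ (suc N))) * Mᵣ N t
        ≈⟨ +-congˡ (solve 5 (λ t q P X M → ((t :* ((q :* P) :* X)) :* M) := (M :* ((P :* t) :* (q :* X))))
                          refl t q (q ^ N) (φ (suc N)) (Mᵣ N t)) ⟩
      Φ N t (transfer N t φ) + Mᵣ N t * ((q ^ N * t) * (q * φ (suc N)))
        ≈⟨ +-congˡ (*-congˡ (*-congˡ (sym (trans (sumRange-single 1 (scale (shift N φ)))
                                                (*-cong (*-identityʳ q) (reflexive (≡.cong φ (ℕ.+-comm N 1)))))))) ⟩
      Φ (suc N) t φ + Mᵣ N t * K 0 (q ^ N * t) (shift N φ) ∎
    lower-levels : diag₋ N (λ k b → Mᵣ k t * K b (q ^ k * t) (shift k (transfer (suc N) t φ)))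
                 ≈ diag₋ N (λ k b → Mᵣ k t * K (suc b) (q ^ k * t) (shift k φ))
    lower-levels = diag₋-cong N (λ k b e → *-congˡ
      (≡.subst (λ N′ → K b (q ^ k * t) (shift k (transfer (suc N′) t φ)) ≈ K (suc b) (q ^ k * t) (shift k φ))
               e (K-step k b t φ)))

  K-one : ∀ b u → K b u (λ _ → 1#) ≈ Ind b u
  K-one b u = begin
    Φ b u (newDescent (suc b) u (λ _ → 1#))
      ≈⟨ Φ-cong b u (λ p r → newDescent-extend b u (λ _ → 1#) p r) ⟩
    Φ b u (λ p → newDescent b u (λ _ → 1#) p + u * (q ^ suc b * 1#))
      ≈⟨ Φ-cong′ b u (λ p → trans (+-congˡ (trans (*-congˡ (*-identityʳ _)) (*-comm u _))) (split-one _ _)) ⟩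
    Φ b u (λ p → transfer b u (λ _ → 1#) p + (q ^ suc b * u - 1#))
      ≈⟨ Φ-+const b u (transfer b u (λ _ → 1#)) _ ⟩
    Ind b u ∎
    where
    split-one : ∀ x y → x + y ≈ (1# + x) + (y - 1#)
    split-one x y = begin
      x + y                 ≈⟨ sym (+-identityʳ _) ⟩
      (x + y) + 0#          ≈⟨ +-congˡ (sym (-‿inverseʳ 1#)) ⟩
      (x + y) + (1# - 1#)   ≈⟨ solve 4 (λ x y o m → ((x :+ y) :+ (o :+ m)) := ((o :+ x) :+ (y :+ m))) refl x y 1# (- 1#) ⟩
      (1# + x) + (y - 1#)   ∎

  second-identity : ∀ N t → Mᵣ (suc N) t ≈ diag N (λ k j → Mᵣ k t * A j (q ^ k * t))
  second-identity N t = begin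
    Mᵣ (suc N) t ≈⟨ Φ-decomposition N t (λ _ → 1#) ⟩
    Mᵣ N t + diag₋ N (λ k b → Mᵣ k t * K b (q ^ k * t) (λ _ → 1#))
      ≈⟨ +-cong (sym (*-identityʳ _)) (diag₋-cong N (λ k b _ → *-congˡ (K-one b (q ^ k * t)))) ⟩
    Mᵣ N t * 1# + diag₋ N (λ k b → Mᵣ k t * A (suc b) (q ^ k * t))
      ≈⟨ +-comm _ _ ⟩
    diag₋ N (λ k b → Mᵣ k t * A (suc b) (q ^ k * t)) + Mᵣ N t * A 0 (q ^ N * t)
      ≈⟨ sym (diag-last N _) ⟩
    diag N (λ k j → Mᵣ k t * A j (q ^ k * t)) ∎

  FirstIdentity : ℕ → Set (c ⊔ ℓ)
  FirstIdentity N = ∀ t → Mᵣ (suc N) t ≈ diag N (λ k j → A k t * Mᵣ j (q ^ suc k * t))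

  -- Expand M_{N+1} by the second identity; the k = 0 term is A_N(t), and
  -- in the others M_k = M_{(k−1)+1} is expanded by the first identity (for
  -- k ≤ N, by induction).  Reassociating the double convolution and
  -- applying the second identity backwards at q^{a+1} t gives the claim.
  first-step : ∀ N → (∀ {k} → k < N → FirstIdentity k) → FirstIdentity N
  first-step N ih t = begin
    Mᵣ (suc N) t ≈⟨ second-identity N t ⟩
    diag N (λ k j → Mᵣ k t * A j (q ^ k * t)) ≈⟨ diag-first N _ ⟩
    1# * A N (1# * t) + diag₋ N (λ k j → Mᵣ (suc k) t * A j (q ^ suc k * t))
      ≈⟨ +-cong (trans (*-identityˡ _) (trans (A-congᵘ N (*-identityˡ t)) (sym (*-identityʳ _)))) (inner N ℕ.≤-refl) ⟩
    A N t * 1# + diag₋ N (λ a m → A a t * Mᵣ (suc m) (q ^ suc a * t)) ≈⟨ +-comm _ _ ⟩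
    diag₋ N (λ a m → A a t * Mᵣ (suc m) (q ^ suc a * t)) + A N t * Mᵣ 0 (q ^ suc N * t) ≈⟨ sym (diag-last N _) ⟩
    diag N (λ k j → A k t * Mᵣ j (q ^ suc k * t)) ∎
    where
    F : ℕ → ℕ → ℕ → Carrier
    F a c j = (A a t * Mᵣ c (q ^ suc a * t)) * A j (q ^ c * (q ^ suc a * t))
    inner : ∀ N′ → N′ ≤ N →
      diag₋ N′ (λ k j → Mᵣ (suc k) t * A j (q ^ suc k * t)) ≈ diag₋ N′ (λ a m → A a t * Mᵣ (suc m) (q ^ suc a * t))
    inner zero _ = refl
    inner (suc n) n<N = begin
      diag n (λ k j → Mᵣ (suc k) t * A j (q ^ suc k * t))
        ≈⟨ diag-cong n (λ k j e → trans (*-congʳ (ih (k<N k j e) t)) (diag-*ʳ k _ _)) ⟩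
      diag n (λ k j → diag k (λ a c → (A a t * Mᵣ c (q ^ suc a * t)) * A j (q ^ suc k * t)))
        ≈⟨ diag-cong n (λ k j _ → diag-cong k (λ a c e → *-congˡ (A-congᵘ j
             (≡.subst (λ k′ → q ^ suc k′ * t ≈ q ^ c * (q ^ suc a * t)) e (^-split q (suc a) c t))))) ⟩
      diag n (λ k j → diag k (λ a c → F a c j)) ≈⟨ diag-assoc n F ⟩
      diag n (λ a m → diag m (λ c j → F a c j))
        ≈⟨ diag-cong n (λ a m _ → trans (diag-cong m (λ c j _ → *-assoc _ _ _))
                                         (sym (trans (*-congˡ (second-identity m (q ^ suc a * t))) (diag-*ˡ m _ _)))) ⟩
      diag n (λ a m → A a t * Mᵣ (suc m) (q ^ suc a * t)) ∎
      where
      k<N : ∀ k j → k +ⁿ j ≡ n → k < N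
      k<N k j e = ℕ.<-≤-trans (s≤s (≡.subst (k ≤_) e (ℕ.m≤m+n k j))) n<N

  first-identity : ∀ N → FirstIdentity N
  first-identity = <-rec FirstIdentity first-step

-- 3. Inserting a new maximum into a 321-avoiding list.
module Insertion where

  <ᵇ-true : ∀ {m n} → m < n → (m <ᵇ n) ≡ true
  <ᵇ-true {m} {n} m<n with m <ᵇ n | ℕ.<⇒<ᵇ m<n
  ... | true | _ = ≡.refl

  <ᵇ-false : ∀ {m n} → n ≤ m → (m <ᵇ n) ≡ false
  <ᵇ-false {m} {n} n≤m with m <ᵇ n in eq
  ... | false = ≡.refl
  ... | true = ⊥-elim (ℕ.<⇒≱ (ℕ.<ᵇ⇒< m n (≡.subst T (≡.sym eq) _)) n≤m)

  <ᵇ-false⇒≥ : ∀ {m n} → (m <ᵇ n) ≡ false → n ≤ m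
  <ᵇ-false⇒≥ eq = ℕ.≮⇒≥ (λ m<n → ≡.subst T eq (ℕ.<⇒<ᵇ m<n))

  increasing : List ℕ → Bool
  increasing [] = true
  increasing (a ∷ []) = true
  increasing (a ∷ b ∷ r) = not (b <ᵇ a) ∧ increasing (b ∷ r)

  increasing-∷ : ∀ a b r → increasing (a ∷ b ∷ r) ≡ true →
                 (b <ᵇ a) ≡ false × increasing (b ∷ r) ≡ true
  increasing-∷ a b r h = Bool.not-injective {y = false} (Bool.∧-conicalˡ _ _ h) , Bool.∧-conicalʳ _ _ h

  orElse : ℕ → ℕ → ℕ
  orElse zero y = y
  orElse (suc r) y = suc r

  -- Position of the last descent of a list whose first entry sits at
  -- position i (0 if there is none).
  lastDesc : ℕ → List ℕ → ℕ
  lastDesc i (a ∷ b ∷ rest) = orElse (lastDesc (suc i) (b ∷ rest)) (if b <ᵇ a then i else 0)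
  lastDesc i _ = 0

  increasing⇒no-descents : ∀ j l → increasing l ≡ true → descentsFrom j l ≡ []
  increasing⇒no-descents j [] _ = ≡.refl
  increasing⇒no-descents j (a ∷ []) _ = ≡.refl
  increasing⇒no-descents j (a ∷ b ∷ r) h =
    ≡.trans (≡.cong (λ B → (if B then j ∷ [] else []) ++ descentsFrom (suc j) (b ∷ r)) (proj₁ (increasing-∷ a b r h)))
            (increasing⇒no-descents (suc j) (b ∷ r) (proj₂ (increasing-∷ a b r h)))

  increasing⇒lastDesc≡0 : ∀ j l → increasing l ≡ true → lastDesc j l ≡ 0
  increasing⇒lastDesc≡0 j [] _ = ≡.refl
  increasing⇒lastDesc≡0 j (a ∷ []) _ = ≡.refl
  increasing⇒lastDesc≡0 j (a ∷ b ∷ r) h =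
    ≡.cong₂ orElse (increasing⇒lastDesc≡0 (suc j) (b ∷ r) (proj₂ (increasing-∷ a b r h)))
                   (≡.cong (λ B → if B then j else 0) (proj₁ (increasing-∷ a b r h)))

  -- Conversely (positions starting at 1 or later, so that 0 means "none").
  lastDesc≡0⇒increasing : ∀ j l → lastDesc (suc j) l ≡ 0 → increasing l ≡ true
  lastDesc≡0⇒increasing j [] _ = ≡.refl
  lastDesc≡0⇒increasing j (a ∷ []) _ = ≡.refl
  lastDesc≡0⇒increasing j (a ∷ b ∷ r) h =
    ≡.cong₂ _∧_ (≡.cong not (if-then≡0 (b <ᵇ a) (proj₂ (orElse≡0 _ _ h))))
                (lastDesc≡0⇒increasing (suc j) (b ∷ r) (proj₁ (orElse≡0 _ _ h)))
    where
    orElse≡0 : ∀ r y → orElse r y ≡ 0 → r ≡ 0 × y ≡ 0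
    orElse≡0 zero y h = ≡.refl , h
    if-then≡0 : ∀ B → (if B then suc j else 0) ≡ 0 → B ≡ false
    if-then≡0 false _ = ≡.refl

  lastDesc≡suc⇒¬increasing : ∀ j l p → lastDesc (suc j) l ≡ suc p → increasing l ≡ false
  lastDesc≡suc⇒¬increasing j l p h with increasing l in e
  ... | false = ≡.refl
  ... | true with () ← ≡.trans (≡.sym h) (increasing⇒lastDesc≡0 (suc j) l e)

  admissibleInsertions : ℕ → List ℕ → List (List ℕ)
  admissibleInsertions x [] = (x ∷ []) ∷ []
  admissibleInsertions x (z ∷ zs) =
    (if increasing (z ∷ zs) then (x ∷ z ∷ zs) ∷ [] else []) ++ map (z ∷_) (admissibleInsertions x zs)

  avoids321 : List ℕ → Bool
  avoids321 σ = not (contains321 σ)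

  filterᵇ-∷ : {A : Set} (p : A → Bool) (x : A) (xs : List A) →
              filterᵇ p (x ∷ xs) ≡ (if p x then x ∷ filterᵇ p xs else filterᵇ p xs)
  filterᵇ-∷ p x xs with p x
  ... | true = ≡.refl
  ... | false = ≡.refl

  filterᵇ-map : {A B : Set} (p : B → Bool) (f : A → B) (L : List A) →
                filterᵇ p (map f L) ≡ map f (filterᵇ (p ∘ f) L)
  filterᵇ-map p f [] = ≡.refl
  filterᵇ-map p f (a ∷ L) with p (f a)
  ... | true = ≡.cong (f a ∷_) (filterᵇ-map p f L)
  ... | false = filterᵇ-map p f L

  filterᵇ-concat : {A B : Set} (p : B → Bool) (f : A → List B) (L : List A) →
                   filterᵇ p (concat (map f L)) ≡ concat (map (filterᵇ p ∘ f) L)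
  filterᵇ-concat p f [] = ≡.refl
  filterᵇ-concat p f (a ∷ L) =
    ≡.trans (List.filter-++ (T? ∘ p) (f a) (concat (map f L))) (≡.cong (filterᵇ p (f a) ++_) (filterᵇ-concat p f L))

  filterᵇ-congAll : {A : Set} {p p′ : A → Bool} {L : List A} → All (λ a → p a ≡ p′ a) L →
                    filterᵇ p L ≡ filterᵇ p′ L
  filterᵇ-congAll {L = []} [] = ≡.refl
  filterᵇ-congAll {p = p} {p′} {a ∷ L} (e ∷ es)
    rewrite filterᵇ-∷ p a L | filterᵇ-∷ p′ a L | e | filterᵇ-congAll es = ≡.refl

  filterᵇ-none : {A : Set} {p : A → Bool} {L : List A} → All (λ a → p a ≡ false) L → filterᵇ p L ≡ []
  filterᵇ-none {p = p} none = List.filter-none (T? ∘ p) (All.map (λ p≡false pa → ≡.subst T p≡false pa) none)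

  increasing-above : ∀ b c r → (c <ᵇ b) ≡ false → increasing (c ∷ r) ≡ true → any (_<ᵇ b) r ≡ false
  increasing-above b c [] _ _ = ≡.refl
  increasing-above b c (e ∷ r) c≮b inc = ≡.cong₂ _∨_ e≮b (increasing-above b e r e≮b (proj₂ (increasing-∷ c e r inc)))
    where
    e≮b : (e <ᵇ b) ≡ false
    e≮b = <ᵇ-false (ℕ.≤-trans (<ᵇ-false⇒≥ {c} {b} c≮b) (<ᵇ-false⇒≥ {e} {c} (proj₁ (increasing-∷ c e r inc))))

  has21Below-head : ∀ b rest → (any (_<ᵇ b) rest ∨ not (increasing rest)) ≡ not (increasing (b ∷ rest))
  has21Below-head b [] = ≡.refl
  has21Below-head b (c ∷ r) with c <ᵇ b in c<b
  ... | true = ≡.refl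
  ... | false with increasing (c ∷ r) in inc
  ...   | false = Bool.∨-zeroʳ _
  ...   | true rewrite increasing-above b c r c<b inc = ≡.refl

  has21Below-max : ∀ x l → All (_< x) l → has21Below x l ≡ not (increasing l)
  has21Below-max x [] [] = ≡.refl
  has21Below-max x (b ∷ rest) (b<x ∷ rs) rewrite <ᵇ-true b<x | has21Below-max x rest rs = has21Below-head b rest

  any-insertions : ∀ x (p : ℕ → Bool) rest → p x ≡ false →
                   All (λ l → any p l ≡ any p rest) (insertions x rest)
  any-insertions x p [] px = ≡.cong (_∨ false) px ∷ []
  any-insertions x p (b ∷ rest) px =
    ≡.cong (_∨ any p (b ∷ rest)) px ∷ All.map⁺ (All.map (≡.cong (p b ∨_)) (any-insertions x p rest px))

  has21Below-insertions : ∀ x y ys → y < x → All (_< x) ys →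
                          All (λ l → has21Below y l ≡ has21Below y ys) (insertions x ys)
  has21Below-insertions x y [] y<x [] = ≡.cong (λ B → (B ∧ false) ∨ false) (<ᵇ-false (ℕ.<⇒≤ y<x)) ∷ []
  has21Below-insertions x y (b ∷ rest) y<x (b<x ∷ rs) =
    ≡.cong (λ B → (B ∧ any (_<ᵇ x) (b ∷ rest)) ∨ has21Below y (b ∷ rest)) (<ᵇ-false (ℕ.<⇒≤ y<x))
    ∷ All.map⁺ (All.map (λ (e₁ , e₂) → ≡.cong₂ (λ a h → ((b <ᵇ y) ∧ a) ∨ h) e₁ e₂)
                        (All.zip (any-insertions x (_<ᵇ b) rest (<ᵇ-false (ℕ.<⇒≤ b<x))
                                 , has21Below-insertions x y rest y<x rs)))

  avoids321-front : ∀ x y ys → All (_< x) (y ∷ ys) → contains321 (y ∷ ys) ≡ false →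
                    avoids321 (x ∷ y ∷ ys) ≡ increasing (y ∷ ys)
  avoids321-front x y ys ys<x c≡false
    rewrite has21Below-max x (y ∷ ys) ys<x | c≡false | Bool.∨-identityʳ (not (increasing (y ∷ ys)))
    = Bool.not-involutive _

  filter-insertions-avoider : ∀ x l → All (_< x) l → contains321 l ≡ false →
                              filterᵇ avoids321 (insertions x l) ≡ admissibleInsertions x l
  filter-insertions-avoider x [] [] _ = ≡.refl
  filter-insertions-avoider x (y ∷ ys) (y<x ∷ ys<x) c≡false = begin
    filterᵇ avoids321 ((x ∷ y ∷ ys) ∷ map (y ∷_) (insertions x ys))
      ≡⟨ filterᵇ-∷ avoids321 (x ∷ y ∷ ys) _ ⟩
    (if avoids321 (x ∷ y ∷ ys) then (x ∷ y ∷ ys) ∷ rest else rest)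
      ≡⟨ ≡.cong (λ B → if B then (x ∷ y ∷ ys) ∷ rest else rest) (avoids321-front x y ys (y<x ∷ ys<x) c≡false) ⟩
    (if increasing (y ∷ ys) then (x ∷ y ∷ ys) ∷ rest else rest)
      ≡⟨ if-++ (increasing (y ∷ ys)) ⟩
    (if increasing (y ∷ ys) then (x ∷ y ∷ ys) ∷ [] else []) ++ rest
      ≡⟨ ≡.cong ((if increasing (y ∷ ys) then (x ∷ y ∷ ys) ∷ [] else []) ++_) rest≡ ⟩
    admissibleInsertions x (y ∷ ys) ∎
    where
    open ≡.≡-Reasoning
    rest = filterᵇ avoids321 (map (y ∷_) (insertions x ys))
    if-++ : ∀ b → (if b then (x ∷ y ∷ ys) ∷ rest else rest) ≡ (if b then (x ∷ y ∷ ys) ∷ [] else []) ++ rest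
    if-++ true = ≡.refl
    if-++ false = ≡.refl
    rest≡ : rest ≡ map (y ∷_) (admissibleInsertions x ys)
    rest≡ = ≡.trans (filterᵇ-map avoids321 (y ∷_) (insertions x ys))
      (≡.cong (map (y ∷_))
        (≡.trans (filterᵇ-congAll (All.map (λ e → ≡.cong (λ h → not (h ∨ _)) (≡.trans e (Bool.∨-conicalˡ _ _ c≡false)))
                                          (has21Below-insertions x y ys y<x ys<x)))
                 (filter-insertions-avoider x ys ys<x (Bool.∨-conicalʳ _ _ c≡false))))

  filter-insertions-container : ∀ x l → All (_< x) l → contains321 l ≡ true →
                                filterᵇ avoids321 (insertions x l) ≡ []
  filter-insertions-container x (y ∷ ys) (y<x ∷ ys<x) c≡true =
    ≡.trans (filterᵇ-∷ avoids321 (x ∷ y ∷ ys) _)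
    (≡.trans (≡.cong (λ B → if B then (x ∷ y ∷ ys) ∷ rest else rest) front-contains)
    (≡.trans (filterᵇ-map avoids321 (y ∷_) (insertions x ys)) (≡.cong (map (y ∷_)) (tails (has21Below y ys) ≡.refl))))
    where
    rest = filterᵇ avoids321 (map (y ∷_) (insertions x ys))
    front-contains : avoids321 (x ∷ y ∷ ys) ≡ false
    front-contains rewrite c≡true | Bool.∨-zeroʳ (has21Below x (y ∷ ys)) = ≡.refl
    same-head : ∀ {h} → has21Below y ys ≡ h →
                All (λ l → avoids321 (y ∷ l) ≡ not (h ∨ contains321 l)) (insertions x ys)
    same-head e = All.map (λ e′ → ≡.cong (λ h → not (h ∨ _)) (≡.trans e′ e)) (has21Below-insertions x y ys y<x ys<x)
    tails : ∀ h → has21Below y ys ≡ h → filterᵇ (avoids321 ∘ (y ∷_)) (insertions x ys) ≡ []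
    tails true e = filterᵇ-none (same-head e)
    tails false e = ≡.trans (filterᵇ-congAll (same-head e))
                            (filter-insertions-container x ys ys<x (≡.subst (λ h → (h ∨ contains321 ys) ≡ true) e c≡true))

  insertions-inv : ∀ (Q : ℕ → Set) x l → Q x → All Q l →
                   All (λ σ → All Q σ × length σ ≡ suc (length l)) (insertions x l)
  insertions-inv Q x [] qx [] = (qx ∷ [] , ≡.refl) ∷ []
  insertions-inv Q x (b ∷ rest) qx (qb ∷ qs) =
    (qx ∷ qb ∷ qs , ≡.refl) ∷ All.map⁺ (All.map (λ (a , e) → qb ∷ a , ≡.cong suc e) (insertions-inv Q x rest qx qs))

  perms-inv : ∀ m → All (λ σ → All (_< suc m) σ × length σ ≡ m) (perms m)
  perms-inv zero = ([] , ≡.refl) ∷ []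
  perms-inv (suc m) = All.concat⁺ (All.map⁺ (All.map
    (λ { {σ} (σ<m+1 , len) → All.map (λ (a , e) → a , ≡.trans e (≡.cong suc len))
           (insertions-inv (_< suc (suc m)) (suc m) σ ℕ.≤-refl (All.map ℕ.m≤n⇒m≤1+n σ<m+1)) })
    (perms-inv m)))

-- 4. Counting 321-avoiders by insertion: M_m(q,t) = Φ m t 1.
module Counting {c ℓ : Level} (R : CommutativeRing c ℓ) (q t : CommutativeRing.Carrier R) where
  open CommutativeRing R hiding (zero)
  open FiniteSums R
  open Transfer R q
  open Insertion
  open import Relation.Binary.Reasoning.Setoid setoid
  open import Algebra.Solver.Ring.NaturalCoefficients.Default commutativeSemiring
    using (solve; _:=_; _:+_; _:*_)

  weight : ℕ → List ℕ → Carrier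
  weight i σ = q ^ sum (descentsFrom i σ) * t ^ length (descentsFrom i σ)

  descentFactor : ℕ → Bool → Carrier
  descentFactor i true = q ^ i * t
  descentFactor i false = 1#

  weight-step : ∀ i y z σ → weight i (y ∷ z ∷ σ) ≈ descentFactor i (z <ᵇ y) * weight (suc i) (z ∷ σ)
  weight-step i y z σ = step (z <ᵇ y) (descentsFrom (suc i) (z ∷ σ))
    where
    step : ∀ b L → q ^ sum ((if b then i ∷ [] else []) ++ L) * t ^ length ((if b then i ∷ [] else []) ++ L)
                   ≈ descentFactor i b * (q ^ sum L * t ^ length L)
    step true L = begin
      q ^ (i +ⁿ sum L) * (t * t ^ length L)         ≈⟨ *-congʳ (^-+ q i (sum L)) ⟩
      (q ^ i * q ^ sum L) * (t * t ^ length L)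
        ≈⟨ solve 4 (λ a b t c → ((a :* b) :* (t :* c)) := ((a :* t) :* (b :* c))) refl (q ^ i) (q ^ sum L) t (t ^ length L) ⟩
      (q ^ i * t) * (q ^ sum L * t ^ length L)      ∎
    step false L = sym (*-identityˡ _)

  weight-increasing : ∀ j l → increasing l ≡ true → weight j l ≈ 1#
  weight-increasing j l h rewrite increasing⇒no-descents j l h = *-identityʳ 1#

  term : ℕ → (ℕ → Carrier) → List ℕ → Carrier
  term i φ σ = weight i σ * φ (lastDesc i σ)

  -- Seen from the tail starting at position i+1, the last descent is the
  -- tail's own, or else the descent at i (if b), or else none.
  stateAfter : (ℕ → Carrier) → ℕ → Bool → ℕ → Carrier
  stateAfter φ i b r = φ (orElse r (if b then i else 0))

  term-step : ∀ i φ y z σ →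
    term i φ (y ∷ z ∷ σ) ≈ descentFactor i (z <ᵇ y) * term (suc i) (stateAfter φ i (z <ᵇ y)) (z ∷ σ)
  term-step i φ y z σ = trans (*-congʳ (weight-step i y z σ)) (*-assoc _ _ _)

  -- Inserting the maximum x in front of an increasing list creates the
  -- only descent, at the insertion position i.
  term-front : ∀ i φ x y l → y < x → increasing (y ∷ l) ≡ true → term i φ (x ∷ y ∷ l) ≈ (q ^ i * t) * φ i
  term-front i φ x y l y<x inc = begin
    weight i (x ∷ y ∷ l) * φ (lastDesc i (x ∷ y ∷ l))
      ≈⟨ *-cong (weight-step i x y l) (reflexive (≡.cong φ last≡i)) ⟩
    (descentFactor i (y <ᵇ x) * weight (suc i) (y ∷ l)) * φ i
      ≈⟨ *-congʳ (*-cong (reflexive (≡.cong (descentFactor i) (<ᵇ-true y<x))) (weight-increasing (suc i) (y ∷ l) inc)) ⟩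
    ((q ^ i * t) * 1#) * φ i
      ≈⟨ *-congʳ (*-identityʳ _) ⟩
    (q ^ i * t) * φ i ∎
    where
    last≡i : lastDesc i (x ∷ y ∷ l) ≡ i
    last≡i rewrite increasing⇒lastDesc≡0 (suc i) (y ∷ l) inc | <ᵇ-true y<x = ≡.refl

  sumOver-if-false : ∀ (f : List ℕ → Carrier) b σ → b ≡ false → sumOver f (if b then σ ∷ [] else []) ≈ 0#
  sumOver-if-false f b σ ≡.refl = refl

  sumOver-if-true : ∀ (f : List ℕ → Carrier) b σ → b ≡ true → sumOver f (if b then σ ∷ [] else []) ≈ f σ
  sumOver-if-true f b σ ≡.refl = +-identityʳ _

  -- The transfer for a list y ∷ l occupying positions i, …, i + |l|, when
  -- the insertion happens after y: with no descent so far, the new descent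
  -- can only be at a position in [i+1, i+|l|].
  transferFrom : ℕ → ℕ → (ℕ → Carrier) → ℕ → Carrier
  transferFrom i m φ zero = φ 0 + t * sumRange (suc i) (i +ⁿ m) (scale φ)
  transferFrom i m φ (suc p) = transfer (i +ⁿ m) t φ (suc p)

  private
    sumRange-stateAfter : ∀ i m b φ a →
      sumRange (suc a) (suc i +ⁿ m) (scale (stateAfter φ i b)) ≈ sumRange (suc a) (i +ⁿ suc m) (scale φ)
    sumRange-stateAfter i m b φ a =
      trans (sumRange-cong-suc a (suc i +ⁿ m) (λ _ → refl)) (sumRange-≡ (scale φ) ≡.refl (≡.sym (ℕ.+-suc i m)))

  -- Combining the two kinds of insertions after the head y of y ∷ z ∷ zs
  -- (in front of z, with contribution fr, or further right), according
  -- to whether the tail z ∷ zs has a descent (at position P+1) …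
  combine-tail-descent : ∀ i m b φ P W fr → fr ≈ 0# →
    fr + descentFactor i b * (W * transferFrom (suc i) m (stateAfter φ i b) (suc P))
      ≈ (descentFactor i b * W) * transferFrom i (suc m) φ (suc P)
  combine-tail-descent i m b φ P W fr fr≈0 = begin
    fr + descentFactor i b * (W * transferFrom (suc i) m (stateAfter φ i b) (suc P))
      ≈⟨ +-cong fr≈0 (sym (*-assoc _ _ _)) ⟩
    0# + (descentFactor i b * W) * transferFrom (suc i) m (stateAfter φ i b) (suc P)
      ≈⟨ +-identityˡ _ ⟩
    (descentFactor i b * W) * transferFrom (suc i) m (stateAfter φ i b) (suc P)
      ≈⟨ *-congˡ (+-congˡ (+-congˡ (*-congˡ (sumRange-stateAfter i m b φ (suc (suc P)))))) ⟩
    (descentFactor i b * W) * transferFrom i (suc m) φ (suc P) ∎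

  -- … or is increasing (then fr is the insertion right after y).
  combine-tail-increasing : ∀ j m b φ W fr → W ≈ 1# → fr ≈ (q ^ suc (suc j) * t) * φ (suc (suc j)) →
    fr + descentFactor (suc j) b * (W * transferFrom (suc (suc j)) m (stateAfter φ (suc j) b) 0)
      ≈ (descentFactor (suc j) b * W) * transferFrom (suc j) (suc m) φ (if b then suc j else 0)
  combine-tail-increasing j m true φ W fr W≈1 fr≈ = begin
    fr + (q ^ i * t) * (W * (φ i + t * sumRange (suc (suc i)) (suc i +ⁿ m) (scale (stateAfter φ i true))))
      ≈⟨ +-cong fr≈ (*-congˡ (trans (*-congʳ W≈1) (trans (*-identityˡ _) (+-congˡ (*-congˡ (sumRange-stateAfter i m true φ (suc i))))))) ⟩
    (q ^ suc i * t) * φ (suc i) + (q ^ i * t) * (φ i + t * S)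
      ≈⟨ solve 6 (λ q P t X₁ X₀ S → (((q :* P) :* t) :* X₁) :+ ((P :* t) :* (X₀ :+ (t :* S)))
                                 := (P :* t) :* (X₀ :+ ((q :* X₁) :+ (t :* S))))
               refl q (q ^ i) t (φ (suc i)) (φ i) S ⟩
    (q ^ i * t) * transferFrom i (suc m) φ i
      ≈⟨ *-congʳ (trans (sym (*-identityʳ _)) (*-congˡ (sym W≈1))) ⟩
    (q ^ i * t * W) * transferFrom i (suc m) φ i ∎
    where
    i = suc j
    S = sumRange (suc (suc i)) (i +ⁿ suc m) (scale φ)
  combine-tail-increasing j m false φ W fr W≈1 fr≈ = begin
    fr + 1# * (W * (φ 0 + t * sumRange (suc (suc i)) (suc i +ⁿ m) (scale (stateAfter φ i false))))
      ≈⟨ +-cong fr≈ (trans (*-identityˡ _) (trans (*-congʳ W≈1) (trans (*-identityˡ _)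
                     (+-congˡ (*-congˡ (sumRange-stateAfter i m false φ (suc i))))))) ⟩
    (q ^ suc i * t) * φ (suc i) + (φ 0 + t * S)
      ≈⟨ solve 5 (λ Q t X₁ X₀ S → ((Q :* t) :* X₁) :+ (X₀ :+ (t :* S)) := X₀ :+ (t :* ((Q :* X₁) :+ S)))
               refl (q ^ suc i) t (φ (suc i)) (φ 0) S ⟩
    φ 0 + t * (scale φ (suc i) + S)
      ≈⟨ +-congˡ (*-congˡ (sym (sumRange-front (suc i) (i +ⁿ suc m) (scale φ) i<i+1+m))) ⟩
    transferFrom i (suc m) φ 0
      ≈⟨ sym (trans (*-congʳ (trans (*-identityˡ _) W≈1)) (*-identityˡ _)) ⟩
    (1# * W) * transferFrom i (suc m) φ 0 ∎
    where
    i = suc j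
    S = sumRange (suc (suc i)) (i +ⁿ suc m) (scale φ)
    i<i+1+m : suc i ≤ i +ⁿ suc m
    i<i+1+m = ≡.subst (suc i ≤_) (≡.sym (ℕ.+-suc i m)) (s≤s (ℕ.m≤m+n i m))

  insertions-after-head : ∀ x j y l φ → All (_< x) (y ∷ l) →
    sumOver (λ σ → term (suc j) φ (y ∷ σ)) (admissibleInsertions x l)
      ≈ weight (suc j) (y ∷ l) * transferFrom (suc j) (length l) φ (lastDesc (suc j) (y ∷ l))
  insertions-after-head x j y [] φ (y<x ∷ []) = begin
    term i φ (y ∷ x ∷ []) + 0#         ≈⟨ +-identityʳ _ ⟩
    term i φ (y ∷ x ∷ [])              ≈⟨ term-step i φ y x [] ⟩
    descentFactor i (x <ᵇ y) * ((1# * 1#) * φ (orElse 0 (if x <ᵇ y then i else 0)))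
      ≈⟨ reflexive (≡.cong (λ B → descentFactor i B * ((1# * 1#) * φ (orElse 0 (if B then i else 0)))) x≮y) ⟩
    1# * ((1# * 1#) * φ 0)             ≈⟨ trans (*-identityˡ _) (*-congˡ (sym transfer-empty)) ⟩
    (1# * 1#) * transferFrom i 0 φ 0   ∎
    where
    i = suc j
    x≮y : (x <ᵇ y) ≡ false
    x≮y = <ᵇ-false (ℕ.<⇒≤ y<x)
    transfer-empty : transferFrom i 0 φ 0 ≈ φ 0
    transfer-empty = trans (+-congˡ (trans (*-congˡ (sumRange-empty (suc i) (i +ⁿ 0) (scale φ)
                                                       (s≤s (ℕ.≤-reflexive (ℕ.+-identityʳ i)))))
                                           (zeroʳ t)))
                           (+-identityʳ _)
  insertions-after-head x j y (z ∷ zs) φ (y<x ∷ z<x ∷ zs<x) = begin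
    sumOver f (front ++ map (z ∷_) (admissibleInsertions x zs))
      ≈⟨ sumOver-++ f front _ ⟩
    fr + sumOver f (map (z ∷_) (admissibleInsertions x zs))
      ≈⟨ +-congˡ (reflexive (sumOver-map f (z ∷_) (admissibleInsertions x zs))) ⟩
    fr + sumOver (λ σ → term i φ (y ∷ z ∷ σ)) (admissibleInsertions x zs)
      ≈⟨ +-congˡ (trans (sumOver-cong (admissibleInsertions x zs) (λ σ → term-step i φ y z σ))
                        (sumOver-* (descentFactor i B) (λ σ → term (suc i) φ′ (z ∷ σ)) (admissibleInsertions x zs))) ⟩
    fr + descentFactor i B * sumOver (λ σ → term (suc i) φ′ (z ∷ σ)) (admissibleInsertions x zs)
      ≈⟨ +-congˡ (*-congˡ (insertions-after-head x (suc j) z zs φ′ (z<x ∷ zs<x))) ⟩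
    fr + descentFactor i B * (W * transferFrom (suc i) (length zs) φ′ (lastDesc (suc i) (z ∷ zs)))
      ≈⟨ combine (lastDesc (suc i) (z ∷ zs)) ≡.refl ⟩
    (descentFactor i B * W) * transferFrom i (suc (length zs)) φ (orElse (lastDesc (suc i) (z ∷ zs)) (if B then i else 0))
      ≈⟨ *-congʳ (sym (weight-step i y z zs)) ⟩
    weight i (y ∷ z ∷ zs) * transferFrom i (length (z ∷ zs)) φ (lastDesc i (y ∷ z ∷ zs)) ∎
    where
    i = suc j
    f = λ σ → term i φ (y ∷ σ)
    B = z <ᵇ y
    φ′ = stateAfter φ i B
    W = weight (suc i) (z ∷ zs)
    front = if increasing (z ∷ zs) then (x ∷ z ∷ zs) ∷ [] else []
    fr = sumOver f front
    combine : ∀ p → lastDesc (suc i) (z ∷ zs) ≡ p →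
      fr + descentFactor i B * (W * transferFrom (suc i) (length zs) φ′ p)
        ≈ (descentFactor i B * W) * transferFrom i (suc (length zs)) φ (orElse p (if B then i else 0))
    combine (suc p) e = combine-tail-descent i (length zs) B φ p W fr
      (sumOver-if-false f (increasing (z ∷ zs)) _ (lastDesc≡suc⇒¬increasing (suc j) (z ∷ zs) p e))
    combine zero e = combine-tail-increasing j (length zs) B φ W fr (weight-increasing (suc i) (z ∷ zs) inc) fr≈
      where
      inc : increasing (z ∷ zs) ≡ true
      inc = lastDesc≡0⇒increasing (suc j) (z ∷ zs) e
      fr≈ : fr ≈ (q ^ suc i * t) * φ (suc i)
      fr≈ = begin
        fr                                                    ≈⟨ sumOver-if-true f (increasing (z ∷ zs)) _ inc ⟩
        term i φ (y ∷ x ∷ z ∷ zs)                             ≈⟨ term-step i φ y x (z ∷ zs) ⟩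
        descentFactor i (x <ᵇ y) * term (suc i) (stateAfter φ i (x <ᵇ y)) (x ∷ z ∷ zs)
          ≈⟨ *-cong (reflexive (≡.cong (descentFactor i) (<ᵇ-false (ℕ.<⇒≤ y<x))))
                    (term-front (suc i) (stateAfter φ i (x <ᵇ y)) x z zs z<x inc) ⟩
        1# * ((q ^ suc i * t) * φ (suc i))                   ≈⟨ *-identityˡ _ ⟩
        (q ^ suc i * t) * φ (suc i)                           ∎

  admissibleInsertions-sum : ∀ x l φ → All (_< x) l →
    sumOver (term 1 φ) (admissibleInsertions x l) ≈ weight 1 l * transfer (length l) t φ (lastDesc 1 l)
  admissibleInsertions-sum x [] φ [] =
    trans (+-identityʳ _) (*-congˡ (sym (trans (+-congˡ (trans (*-congˡ (sumRange-empty 1 0 (scale φ) (s≤s z≤n))) (zeroʳ t)))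
                                                 (+-identityʳ _))))
  admissibleInsertions-sum x (y ∷ l) φ (y<x ∷ l<x) = begin
    sumOver (term 1 φ) (front ++ map (y ∷_) (admissibleInsertions x l))
      ≈⟨ sumOver-++ (term 1 φ) front _ ⟩
    fr + sumOver (term 1 φ) (map (y ∷_) (admissibleInsertions x l))
      ≈⟨ +-congˡ (reflexive (sumOver-map (term 1 φ) (y ∷_) (admissibleInsertions x l))) ⟩
    fr + sumOver (λ σ → term 1 φ (y ∷ σ)) (admissibleInsertions x l)
      ≈⟨ +-congˡ (insertions-after-head x 0 y l φ (y<x ∷ l<x)) ⟩
    fr + W * transferFrom 1 (length l) φ (lastDesc 1 (y ∷ l))
      ≈⟨ combine (lastDesc 1 (y ∷ l)) ≡.refl ⟩
    W * transfer (suc (length l)) t φ (lastDesc 1 (y ∷ l)) ∎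
    where
    front = if increasing (y ∷ l) then (x ∷ y ∷ l) ∷ [] else []
    fr = sumOver (term 1 φ) front
    m = length l
    W = weight 1 (y ∷ l)
    combine : ∀ p → lastDesc 1 (y ∷ l) ≡ p → fr + W * transferFrom 1 m φ p ≈ W * transfer (suc m) t φ p
    combine (suc p) e =
      trans (+-congʳ (sumOver-if-false (term 1 φ) (increasing (y ∷ l)) _ (lastDesc≡suc⇒¬increasing 0 (y ∷ l) p e)))
            (+-identityˡ _)
    combine zero e = begin
      fr + W * transferFrom 1 m φ 0
        ≈⟨ +-cong (trans (sumOver-if-true (term 1 φ) (increasing (y ∷ l)) _ inc) (term-front 1 φ x y l y<x inc))
                  (trans (*-congʳ W≈1) (*-identityˡ _)) ⟩
      (q ^ 1 * t) * φ 1 + (φ 0 + t * sumRange 2 (suc m) (scale φ))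
        ≈⟨ solve 5 (λ P t X₁ X₀ S → ((P :* t) :* X₁) :+ (X₀ :+ (t :* S)) := X₀ :+ (t :* ((P :* X₁) :+ S)))
                 refl (q ^ 1) t (φ 1) (φ 0) (sumRange 2 (suc m) (scale φ)) ⟩
      φ 0 + t * (scale φ 1 + sumRange 2 (suc m) (scale φ))
        ≈⟨ +-congˡ (*-congˡ (sym (sumRange-front 1 (suc m) (scale φ) (s≤s z≤n)))) ⟩
      transfer (suc m) t φ 0
        ≈⟨ sym (trans (*-congʳ W≈1) (*-identityˡ _)) ⟩
      W * transfer (suc m) t φ 0 ∎
      where
      inc : increasing (y ∷ l) ≡ true
      inc = lastDesc≡0⇒increasing 0 (y ∷ l) e
      W≈1 : W ≈ 1#
      W≈1 = weight-increasing 1 (y ∷ l) inc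

  insertions-sum : ∀ m φ σ → All (_< suc m) σ × length σ ≡ m →
    sumOver (term 1 φ) (filterᵇ avoids321 (insertions (suc m) σ))
      ≈ (if avoids321 σ then term 1 (transfer m t φ) σ else 0#)
  insertions-sum m φ σ (σ<m+1 , len) with contains321 σ in c
  ... | true = reflexive (≡.cong (sumOver (term 1 φ)) (filter-insertions-container (suc m) σ σ<m+1 c))
  ... | false = begin
    sumOver (term 1 φ) (filterᵇ avoids321 (insertions (suc m) σ))
      ≈⟨ reflexive (≡.cong (sumOver (term 1 φ)) (filter-insertions-avoider (suc m) σ σ<m+1 c)) ⟩
    sumOver (term 1 φ) (admissibleInsertions (suc m) σ)
      ≈⟨ admissibleInsertions-sum (suc m) σ φ σ<m+1 ⟩
    weight 1 σ * transfer (length σ) t φ (lastDesc 1 σ)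
      ≈⟨ reflexive (≡.cong (λ n → weight 1 σ * transfer n t φ (lastDesc 1 σ)) len) ⟩
    weight 1 σ * transfer m t φ (lastDesc 1 σ) ∎

  Av321-sum : ∀ m φ → sumOver (term 1 φ) (Av321 m) ≈ Φ m t φ
  Av321-sum zero φ = trans (+-identityʳ _) (trans (*-congʳ (*-identityʳ _)) (*-identityˡ _))
  Av321-sum (suc m) φ = begin
    sumOver (term 1 φ) (filterᵇ avoids321 (concat (map (insertions (suc m)) (perms m))))
      ≈⟨ reflexive (≡.cong (sumOver (term 1 φ)) (filterᵇ-concat avoids321 (insertions (suc m)) (perms m))) ⟩
    sumOver (term 1 φ) (concat (map (filterᵇ avoids321 ∘ insertions (suc m)) (perms m)))
      ≈⟨ sumOver-concat (term 1 φ) _ (perms m) ⟩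
    sumOver (λ σ → sumOver (term 1 φ) (filterᵇ avoids321 (insertions (suc m) σ))) (perms m)
      ≈⟨ sumOver-congAll (All.map (insertions-sum m φ _) (perms-inv m)) ⟩
    sumOver (λ σ → if avoids321 σ then term 1 (transfer m t φ) σ else 0#) (perms m)
      ≈⟨ sym (sumOver-filter avoids321 (term 1 (transfer m t φ)) (perms m)) ⟩
    sumOver (term 1 (transfer m t φ)) (Av321 m)
      ≈⟨ Av321-sum m (transfer m t φ) ⟩
    Φ (suc m) t φ ∎

  M≈Mᵣ : ∀ m → M R m q t ≈ Mᵣ m t
  M≈Mᵣ m = trans (sumOver-cong (Av321 m) (λ σ → sym (*-identityʳ _))) (Av321-sum m (λ _ → 1#))

-- 5. The identities with the summation conventions of the statement.
module Identities {c ℓ : Level} (R : CommutativeRing c ℓ) (q : CommutativeRing.Carrier R) where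
  open CommutativeRing R hiding (zero)
  open FiniteSums R
  open Transfer R q
  open import Relation.Binary.Reasoning.Setoid setoid

  M≈Mᵣ : ∀ m u → M R m q u ≈ Mᵣ m u
  M≈Mᵣ m u = Counting.M≈Mᵣ R q u m

  firstSummand : ℕ → Carrier → ℕ → Carrier
  firstSummand n t k = (M R (k ∸ 1) q t + (q ^ (k ∸ 1) * t - 1#) * M R (k ∸ 2) q t) * M R (n ∸ k) q (q ^ k * t)

  secondSummand : ℕ → Carrier → ℕ → Carrier
  secondSummand n t k =
    M R k q t * (M R (n ∸ k ∸ 1) q (q ^ k * t) + (q ^ (n ∸ 1) * t - 1#) * M R (n ∸ k ∸ 2) q (q ^ k * t))

  firstSummand≈ : ∀ k j t → firstSummand (suc (suc (k +ⁿ j))) t (suc (suc k)) ≈ Ind k t * Mᵣ j (q ^ suc (suc k) * t)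
  firstSummand≈ k j t =
    *-cong (+-cong (M≈Mᵣ (suc k) t) (*-congˡ (M≈Mᵣ k t)))
           (trans (reflexive (≡.cong (λ m → M R m q (q ^ suc (suc k) * t)) (ℕ.m+n∸m≡n k j))) (M≈Mᵣ j _))

  secondSummand≈ : ∀ k j t → secondSummand (suc (suc (k +ⁿ j))) t k ≈ Mᵣ k t * Ind j (q ^ k * t)
  secondSummand≈ k j t =
    *-cong (M≈Mᵣ k t) (+-cong (trans (M-at (λ m → m ∸ 1)) (M≈Mᵣ (suc j) _))
                              (*-cong (+-congʳ q-power) (trans (M-at (λ m → m ∸ 2)) (M≈Mᵣ j _))))
    where
    n-k : suc (suc (k +ⁿ j)) ∸ k ≡ suc (suc j)
    n-k = ≡.trans (≡.cong (_∸ k) (≡.trans (≡.cong suc (≡.sym (ℕ.+-suc k j))) (≡.sym (ℕ.+-suc k (suc j)))))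
                  (ℕ.m+n∸m≡n k (suc (suc j)))
    M-at : ∀ (g : ℕ → ℕ) → M R (g (suc (suc (k +ⁿ j)) ∸ k)) q (q ^ k * t) ≈ M R (g (suc (suc j))) q (q ^ k * t)
    M-at g = reflexive (≡.cong (λ m → M R (g m) q (q ^ k * t)) n-k)
    q-power : q ^ suc (k +ⁿ j) * t ≈ q ^ suc j * (q ^ k * t)
    q-power = trans (reflexive (≡.cong (λ n → q ^ n * t) (≡.sym (ℕ.+-suc k j)))) (^-split q k (suc j) t)

  first-as-list : ∀ N t →
    M R (suc N) q t ≈ M R N q (q * t) + sumOver (firstSummand (suc N) t) (map (λ i → suc (suc i)) (upTo N))
  first-as-list N t = begin
    M R (suc N) q t ≈⟨ M≈Mᵣ (suc N) t ⟩
    Mᵣ (suc N) t    ≈⟨ first-identity N t ⟩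
    diag N (λ k j → A k t * Mᵣ j (q ^ suc k * t)) ≈⟨ diag-first N _ ⟩
    1# * Mᵣ N (q ^ 1 * t) + diag₋ N (λ k j → Ind k t * Mᵣ j (q ^ suc (suc k) * t))
      ≈⟨ +-cong (trans (*-identityˡ _) (trans (Mᵣ-congᵘ N (*-congʳ (*-identityʳ q))) (sym (M≈Mᵣ N (q * t)))))
                (sym sums) ⟩
    M R N q (q * t) + sumOver (firstSummand (suc N) t) (map (λ i → suc (suc i)) (upTo N)) ∎
    where
    sums : sumOver (firstSummand (suc N) t) (map (λ i → suc (suc i)) (upTo N))
         ≈ diag₋ N (λ k j → Ind k t * Mᵣ j (q ^ suc (suc k) * t))
    sums = trans (reflexive (sumOver-map _ _ (upTo N))) (trans (sumOver-applyUpTo _ id N) (sumBelow-diag₋ N _ _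
      (λ k j e → ≡.subst (λ n → firstSummand (suc n) t (suc (suc k)) ≈ Ind k t * Mᵣ j (q ^ suc (suc k) * t))
                         e (firstSummand≈ k j t))))

  second-as-list : ∀ N t →
    M R (suc N) q t ≈ M R N q t + sumOver (secondSummand (suc N) t) (upTo N)
  second-as-list N t = begin
    M R (suc N) q t ≈⟨ M≈Mᵣ (suc N) t ⟩
    Mᵣ (suc N) t    ≈⟨ second-identity N t ⟩
    diag N (λ k j → Mᵣ k t * A j (q ^ k * t)) ≈⟨ diag-last N _ ⟩
    diag₋ N (λ k j → Mᵣ k t * Ind j (q ^ k * t)) + Mᵣ N t * 1# ≈⟨ +-comm _ _ ⟩
    Mᵣ N t * 1# + diag₋ N (λ k j → Mᵣ k t * Ind j (q ^ k * t))
      ≈⟨ +-cong (trans (*-identityʳ _) (sym (M≈Mᵣ N t))) (sym sums) ⟩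
    M R N q t + sumOver (secondSummand (suc N) t) (upTo N) ∎
    where
    sums : sumOver (secondSummand (suc N) t) (upTo N) ≈ diag₋ N (λ k j → Mᵣ k t * Ind j (q ^ k * t))
    sums = trans (sumOver-applyUpTo _ id N) (sumBelow-diag₋ N _ _
      (λ k j e → ≡.subst (λ n → secondSummand (suc n) t k ≈ Mᵣ k t * Ind j (q ^ k * t))
                         e (secondSummand≈ k j t)))

theorem6p2 : {c ℓ : Level} (R : CommutativeRing c ℓ) →
    let open CommutativeRing R in
    (n : ℕ) → 1 ≤ n → (q t : Carrier) →
      (M R n q t ≈ M R (n ∸ 1) q (q * t)
        + sumR R (map (λ k → (M R (k ∸ 1) q t + (pow R q (k ∸ 1) * t - 1#) * M R (k ∸ 2) q t) * M R (n ∸ k) q (pow R q k * t)) (map (λ i → suc (suc i)) (upTo (n ∸ 1)))))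
      × (M R n q t ≈ M R (n ∸ 1) q t
        + sumR R (map (λ k → M R k q t * (M R (n ∸ k ∸ 1) q (pow R q k * t) + (pow R q (n ∸ 1) * t - 1#) * M R (n ∸ k ∸ 2) q (pow R q k * t))) (upTo (n ∸ 1))))
theorem6p2 R (suc N) (s≤s z≤n) q t = first-as-list N t , second-as-list N t
  where open Identities R q
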